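{- Let $p$ be prime, $T\in(\mathbb{Z}/p)[x]$, and $0\leq r<p$. Then for all $k\geq1$, \[a_{T^p}(pk+r)=(p-r)\,a_T(k)+r\,a_T(k+1)+1-p.\]
   Context: For a prime $p$ and $S\in(\mathbb{Z}/p)[x]$, the automaton $A_p(1;S)$ has line $r\geq0$ equal to $S(x)^r\in(\mathbb{Z}/p)[x]$ (the initial state is $1$). Each line is identified with the bi-infinite sequence $(a_j)_{j\in\mathbb{Z}}$ of its coefficients, with zeros outside the support. A string $w\in(\mathbb{Z}/p)^k$ is $k$-accessible if $w=(a_j,\dots,a_{j+k-1})$ for some line and some $j\in\mathbb{Z}$. $a_S(k)$ denotes the number of $k$-accessible blocks of $A_p(1;S)$ for $k\geq1$, with $a_S(0)=1$. -}

module Defs where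

open import Data.Nat using (ℕ; zero; suc; _+_; _*_; NonZero)
open import Data.Nat.DivMod using (_mod_)
open import Data.Integer using (ℤ; +_; -[1+_])
open import Data.Fin using (Fin; toℕ)
open import Data.List using (List; []; _∷_; map; length)
open import Data.List.Membership.Propositional using (_∈_)
open import Data.List.Relation.Unary.Unique.Propositional using (Unique)
open import Data.Vec using (Vec; lookup)
open import Data.Product using (Σ; ∃; _×_)
open import Relation.Binary.PropositionalEquality using (_≡_)
open import Function.Bundles using (_⇔_)

-- Polynomials with natural-number coefficients, as coefficient lists
-- (constant term first).  Elements of (ℤ/p)[x] are lists in  Fin p.

polyAdd : List ℕ → List ℕ → List ℕ
polyAdd [] q = q
polyAdd (a ∷ as) [] = a ∷ as
polyAdd (a ∷ as) (b ∷ bs) = (a + b) ∷ polyAdd as bs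

polyMul : List ℕ → List ℕ → List ℕ
polyMul [] q = []
polyMul (a ∷ as) q = polyAdd (map (a *_) q) (0 ∷ polyMul as q)

polyPow : List ℕ → ℕ → List ℕ
polyPow s zero = 1 ∷ []
polyPow s (suc r) = polyMul s (polyPow s r)

coeffAt : List ℕ → ℕ → ℕ
coeffAt [] n = 0
coeffAt (a ∷ as) zero = a
coeffAt (a ∷ as) (suc n) = coeffAt as n

coeffℤ : List ℕ → ℤ → ℕ
coeffℤ s (+ n) = coeffAt s n
coeffℤ s -[1+ n ] = 0

-- lift (ℤ/p)[x] to ℕ[x] (reduction mod p is a ring homomorphism, so
-- computing in ℕ[x] and reducing gives the arithmetic of (ℤ/p)[x])
lift : {p : ℕ} → List (Fin p) → List ℕ
lift = map toℕ

powZp : (p : ℕ) .{{_ : NonZero p}} → List (Fin p) → ℕ → List (Fin p)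
powZp p S m = map (λ c → c mod p) (polyPow (lift S) m)

-- line r of the automaton A_p(1;S): the bi-infinite coefficient sequence of S(x)^r
line : (p : ℕ) .{{_ : NonZero p}} → List (Fin p) → ℕ → ℤ → Fin p
line p S r j = coeffℤ (polyPow (lift S) r) j mod p

Accessible : (p : ℕ) .{{_ : NonZero p}} → List (Fin p) → (k : ℕ) → Vec (Fin p) k → Set
Accessible p S k w =
  Σ ℕ λ r → Σ ℤ λ j → (i : Fin k) → lookup w i ≡ line p S r (j Data.Integer.+ + toℕ i)

-- a_S(k) = n : the set of k-accessible blocks has exactly n elements
-- (witnessed by a duplicate-free list enumerating exactly the accessible blocks)
NumAccessible : (p : ℕ) .{{_ : NonZero p}} → List (Fin p) → (k : ℕ) → ℕ → Set
NumAccessible p S k n =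
  Σ (List (Vec (Fin p) k)) λ ws →
    Unique ws × ((w : Vec (Fin p) k) → (w ∈ ws ⇔ Accessible p S k w)) × length ws ≡ n

-- Modulo p, f(x)ᵖ = f(xᵖ) (binomial theorem with p ∣ (p choose k), then Fermat), so line r of A_p(1;Tᵖ)
-- is line r of A_p(1;T) with p − 1 zeros inserted after every coefficient.  Hence a block of length
-- pk + r of A_p(1;Tᵖ) vanishes outside one residue class s mod p of its positions, and along that class it
-- reads a block of A_p(1;T) of length k + 1 if s < r and of length k otherwise; conversely every such
-- block, written along class s, occurs.  Nonzero blocks for different s differ, so counting the zero
-- block once gives a_{Tᵖ}(pk + r) = 1 + r (a_T(k+1) − 1) + (p − r) (a_T(k) − 1).
module Submission where

open import Defs
open import Data.Nat
  using (ℕ; zero; suc; _+_; _*_; _∸_; _<_; _≤_; _!; _%_; _/_; NonZero; z≤n; s≤s; s≤s⁻¹; _≟_; _<?_; >-nonZero⁻¹)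
open import Data.Nat.Properties
open import Data.Nat.DivMod
  using (_mod_; m%n<n; m%n%n≡m%n; %-distribˡ-+; %-distribˡ-*; n%n≡0; [m+n]%n≡m%n; [m+kn]%n≡m%n; m<n⇒m%n≡m;
         m≡m%n+[m/n]*n; m/n*n≡m; m/n*n≤m; m*n/n≡m; m<n⇒m/n≡0; +-distrib-/-∣ʳ)
open import Data.Nat.Divisibility using (_∣_; _∤_; divides; ∣⇒≤; ∣1⇒≡1; m∣m*n; ∣m⇒∣m*n; n∣m⇒m%n≡0)
open import Data.Nat.Primality using (Prime; euclidsLemma; ¬prime[0]; ¬prime[1])
open import Data.Nat.Combinatorics using (_C_; nCn≡1; k![n∸k]!∣n!)
open import Data.Nat.Combinatorics.Specification using (nCk≡n!/k![n-k]!)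
import Data.Integer as ℤ
open ℤ using (ℤ; _⊖_)
import Data.Integer.Properties as ℤ
open import Data.Integer.DivMod using (_%ℕ_; _/ℕ_; n%ℕd<d; a≡a%ℕn+[a/ℕn]*n)
open import Data.Integer.Solver using (module +-*-Solver)
open import Data.Fin using (Fin; toℕ; fromℕ; fromℕ<; inject₁) renaming (zero to fzero; suc to fsuc)
open import Data.Fin.Properties
  using (toℕ<n; toℕ-fromℕ; toℕ-fromℕ<; toℕ-injective; inject₁ℕ<) renaming (_≟_ to _≟ᶠ_)
open import Data.Vec using (Vec; []; _∷_; lookup; tabulate)
import Data.Vec as Vec
open import Data.Vec.Properties
  using (lookup∘tabulate; lookup-replicate; ≡-dec; tabulate∘lookup; tabulate-cong)
open import Data.List using (List; []; _∷_; length; map; filter; replicate; _++_)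
open import Data.List.Properties using (filter-all; filter-accept; filter-reject; length-map; length-++)
open import Data.List.Membership.Propositional using (_∈_)
open import Data.List.Membership.Propositional.Properties
  using (∈-map∘filter⁻; ∈-map∘filter⁺; ∈-++⁺ˡ; ∈-++⁺ʳ; ∈-++⁻)
open import Data.List.Relation.Unary.Any using (here; there)
import Data.List.Relation.Unary.All as All
open import Data.List.Relation.Unary.AllPairs using ([]; _∷_)
open import Data.List.Relation.Unary.Unique.Propositional using (Unique)
import Data.List.Relation.Unary.Unique.Propositional.Properties as Unique
open import Data.List.Relation.Binary.Disjoint.Propositional using (Disjoint)
open import Data.Product using (Σ; ∃; _×_; _,_; proj₁; proj₂)
open import Data.Sum using (inj₁; inj₂)
open import Data.Empty using (⊥-elim)
open import Level using (0ℓ)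
open import Relation.Binary.Core using (Rel)
open import Relation.Binary.Structures using (IsEquivalence)
open import Relation.Binary.Bundles using (Setoid)
open import Relation.Binary.Definitions using (DecidableEquality)
import Relation.Binary.Construct.On as On
open import Relation.Binary.PropositionalEquality
open import Relation.Nullary using (yes; no; Dec; ¬?)
open import Function.Base using (_∘_; flip)
open import Function.Bundles using (_⇔_; mk⇔; Equivalence)
open import Algebra.Bundles using (CommutativeMonoid; CommutativeSemiring)
open import Algebra.Structures.Biased using (IsCommutativeSemiringˡ)
import Algebra.Properties.CommutativeSemigroup as CommutativeSemigroupProperties
import Algebra.Properties.Semiring.Exp as SemiringExp
import Algebra.Properties.CommutativeSemiring.Binomial as Binomial
import Algebra.Properties.CommutativeSemiring.Exp as CommutativeSemiringExp
import Algebra.Properties.Monoid.Sum as MonoidSum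
import Algebra.Properties.Monoid.Mult as MonoidMult

open CommutativeSemigroupProperties +-commutativeSemigroup
  using () renaming (x∙yz≈y∙xz to m+[n+o]≡n+[m+o]; x∙yz≈z∙yx to m+[n+o]≡o+[n+m])

-- Polynomial arithmetic on coefficient lists

coeffAt-polyAdd : ∀ f g n → coeffAt (polyAdd f g) n ≡ coeffAt f n + coeffAt g n
coeffAt-polyAdd []      g       n       = refl
coeffAt-polyAdd (a ∷ f) []      n       = sym (+-identityʳ _)
coeffAt-polyAdd (a ∷ f) (b ∷ g) zero    = refl
coeffAt-polyAdd (a ∷ f) (b ∷ g) (suc n) = coeffAt-polyAdd f g n

coeffAt-scale : ∀ c f n → coeffAt (map (c *_) f) n ≡ c * coeffAt f n
coeffAt-scale c []      n       = sym (*-zeroʳ c)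
coeffAt-scale c (a ∷ f) zero    = refl
coeffAt-scale c (a ∷ f) (suc n) = coeffAt-scale c f n

-- Equality of coefficient lists up to trailing zeros, with coefficients compared by a congruence _∼_
-- on (ℕ, +, *): with _≡_ this is equality in ℕ[x], with congruence mod p equality in (ℤ/p)[x].
module Coefficientwise {_∼_ : Rel ℕ 0ℓ} (∼-isEquivalence : IsEquivalence _∼_)
  (+-cong : ∀ x x′ y y′ → x ∼ x′ → y ∼ y′ → (x + y) ∼ (x′ + y′))
  (*-cong : ∀ x x′ y y′ → x ∼ x′ → y ∼ y′ → (x * y) ∼ (x′ * y′)) where

  open IsEquivalence ∼-isEquivalence renaming (refl to ∼-refl; sym to ∼-sym; trans to ∼-trans)

  infix 4 _≈_
  record _≈_ (f g : List ℕ) : Set where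
    constructor coeffwise
    field coeff : ∀ n → coeffAt f n ∼ coeffAt g n
  open _≈_ public

  ≈-refl : ∀ {f} → f ≈ f
  ≈-refl = coeffwise λ n → ∼-refl

  ≈-sym : ∀ {f g} → f ≈ g → g ≈ f
  ≈-sym e = coeffwise λ n → ∼-sym (coeff e n)

  ≈-trans : ∀ {f g h} → f ≈ g → g ≈ h → f ≈ h
  ≈-trans e e′ = coeffwise λ n → ∼-trans (coeff e n) (coeff e′ n)

  ≈-isEquivalence : IsEquivalence _≈_
  ≈-isEquivalence = record { refl = ≈-refl ; sym = ≈-sym ; trans = ≈-trans }

  ≈-setoid : Setoid 0ℓ 0ℓ
  ≈-setoid = record { isEquivalence = ≈-isEquivalence }

  ≡⇒≈ : ∀ {f g} → f ≡ g → f ≈ g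
  ≡⇒≈ refl = ≈-refl

  ∷-cong : ∀ {a b f g} → a ∼ b → f ≈ g → (a ∷ f) ≈ (b ∷ g)
  ∷-cong a∼b e = coeffwise λ { zero → a∼b ; (suc n) → coeff e n }

  ∷-injectiveˡ : ∀ {a b f g} → (a ∷ f) ≈ (b ∷ g) → a ∼ b
  ∷-injectiveˡ e = coeff e 0

  ∷-injectiveʳ : ∀ {a b f g} → (a ∷ f) ≈ (b ∷ g) → f ≈ g
  ∷-injectiveʳ e = coeffwise λ n → coeff e (suc n)

  polyAdd-cong : ∀ {f f′ g g′} → f ≈ f′ → g ≈ g′ → polyAdd f g ≈ polyAdd f′ g′
  polyAdd-cong {f} {f′} {g} {g′} e e′ = coeffwise λ n →
    subst₂ _∼_ (sym (coeffAt-polyAdd f g n)) (sym (coeffAt-polyAdd f′ g′ n))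
      (+-cong (coeffAt f n) (coeffAt f′ n) (coeffAt g n) (coeffAt g′ n) (coeff e n) (coeff e′ n))

  pad-cong : ∀ n {f g} → f ≈ g → replicate n 0 ++ f ≈ replicate n 0 ++ g
  pad-cong zero    e = e
  pad-cong (suc n) e = ∷-cong ∼-refl (pad-cong n e)

  scale-cong : ∀ {a b f g} → a ∼ b → f ≈ g → map (a *_) f ≈ map (b *_) g
  scale-cong {a} {b} {f} {g} a∼b e = coeffwise λ n →
    subst₂ _∼_ (sym (coeffAt-scale a f n)) (sym (coeffAt-scale b g n))
      (*-cong a b (coeffAt f n) (coeffAt g n) a∼b (coeff e n))

  scale-by-zero : ∀ f → map (0 *_) f ≈ []
  scale-by-zero f = coeffwise λ n → reflexive (coeffAt-scale 0 f n)

  zero∷[]≈[] : (0 ∷ []) ≈ []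
  zero∷[]≈[] = coeffwise λ { zero → ∼-refl ; (suc n) → ∼-refl }

  polyMul-zeroˡ : ∀ f g → f ≈ [] → polyMul f g ≈ []
  polyMul-zeroˡ []      g e = ≈-refl
  polyMul-zeroˡ (a ∷ f) g e = ≈-trans
    (polyAdd-cong (≈-trans (scale-cong (coeff e 0) ≈-refl) (scale-by-zero g))
                  (∷-cong ∼-refl (polyMul-zeroˡ f g (coeffwise λ n → coeff e (suc n)))))
    zero∷[]≈[]

  polyMul-cong : ∀ {f f′ g g′} → f ≈ f′ → g ≈ g′ → polyMul f g ≈ polyMul f′ g′
  polyMul-cong {[]}    {f′}     e e′ = ≈-sym (polyMul-zeroˡ f′ _ (≈-sym e))
  polyMul-cong {a ∷ f} {[]}     e e′ = polyMul-zeroˡ (a ∷ f) _ e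
  polyMul-cong {a ∷ f} {b ∷ f′} e e′ =
    polyAdd-cong (scale-cong (∷-injectiveˡ e) e′) (∷-cong ∼-refl (polyMul-cong (∷-injectiveʳ e) e′))

  polyPow-cong : ∀ {f g} → f ≈ g → ∀ n → polyPow f n ≈ polyPow g n
  polyPow-cong e zero    = ≈-refl
  polyPow-cong e (suc n) = polyMul-cong e (polyPow-cong e n)

module ≋ = Coefficientwise {_≡_} isEquivalence (λ _ _ _ _ → cong₂ _+_) (λ _ _ _ _ → cong₂ _*_)
open ≋ using (coeffwise; coeff; ≡⇒≈)
  renaming (_≈_ to _≋_; ≈-refl to ≋-refl; ≈-sym to ≋-sym; ≈-trans to ≋-trans)

polyAdd-assoc : ∀ f g h → polyAdd (polyAdd f g) h ≡ polyAdd f (polyAdd g h)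
polyAdd-assoc []      g       h       = refl
polyAdd-assoc (a ∷ f) []      h       = refl
polyAdd-assoc (a ∷ f) (b ∷ g) []      = refl
polyAdd-assoc (a ∷ f) (b ∷ g) (c ∷ h) = cong₂ _∷_ (+-assoc a b c) (polyAdd-assoc f g h)

polyAdd-comm : ∀ f g → polyAdd f g ≡ polyAdd g f
polyAdd-comm []      []      = refl
polyAdd-comm []      (b ∷ g) = refl
polyAdd-comm (a ∷ f) []      = refl
polyAdd-comm (a ∷ f) (b ∷ g) = cong₂ _∷_ (+-comm a b) (polyAdd-comm f g)

polyAdd-identityʳ : ∀ f → polyAdd f [] ≡ f
polyAdd-identityʳ []      = refl
polyAdd-identityʳ (a ∷ f) = refl

polyAdd-commutativeMonoid : CommutativeMonoid 0ℓ 0ℓ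
polyAdd-commutativeMonoid = record
  { Carrier = List ℕ ; _≈_ = _≡_ ; _∙_ = polyAdd ; ε = []
  ; isCommutativeMonoid = record
    { isMonoid = record
      { isSemigroup = record
        { isMagma = record { isEquivalence = isEquivalence ; ∙-cong = cong₂ polyAdd }
        ; assoc = polyAdd-assoc }
      ; identity = (λ f → refl) , polyAdd-identityʳ }
    ; comm = polyAdd-comm } }

open CommutativeSemigroupProperties (CommutativeMonoid.commutativeSemigroup polyAdd-commutativeMonoid)
  using (interchange; x∙yz≈y∙xz)

scale-distrib-polyAdd : ∀ c f g → map (c *_) (polyAdd f g) ≡ polyAdd (map (c *_) f) (map (c *_) g)
scale-distrib-polyAdd c []      g       = refl
scale-distrib-polyAdd c (a ∷ f) []      = refl
scale-distrib-polyAdd c (a ∷ f) (b ∷ g) = cong₂ _∷_ (*-distribˡ-+ c a b) (scale-distrib-polyAdd c f g)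

scale-distrib-+ : ∀ a b f → map ((a + b) *_) f ≡ polyAdd (map (a *_) f) (map (b *_) f)
scale-distrib-+ a b []      = refl
scale-distrib-+ a b (c ∷ f) = cong₂ _∷_ (*-distribʳ-+ c a b) (scale-distrib-+ a b f)

scale-scale : ∀ a b f → map (a *_) (map (b *_) f) ≡ map ((a * b) *_) f
scale-scale a b []      = refl
scale-scale a b (c ∷ f) = cong₂ _∷_ (sym (*-assoc a b c)) (scale-scale a b f)

scale-identity : ∀ f → map (1 *_) f ≡ f
scale-identity []      = refl
scale-identity (a ∷ f) = cong₂ _∷_ (*-identityˡ a) (scale-identity f)

one : List ℕ
one = 1 ∷ []

polyMul-identityˡ : ∀ g → polyMul one g ≋ g
polyMul-identityˡ g =
  ≋-trans (≋.polyAdd-cong (≡⇒≈ (scale-identity g)) ≋.zero∷[]≈[]) (≡⇒≈ (polyAdd-identityʳ g))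

polyMul-zeroʳ : ∀ f → polyMul f [] ≋ []
polyMul-zeroʳ []      = ≋-refl
polyMul-zeroʳ (a ∷ f) = ≋-trans (≋.∷-cong refl (polyMul-zeroʳ f)) ≋.zero∷[]≈[]

polyMul-shiftˡ : ∀ f g → polyMul (0 ∷ f) g ≋ (0 ∷ polyMul f g)
polyMul-shiftˡ f g = ≋.polyAdd-cong (≋.scale-by-zero g) ≋-refl

polyMul-∷ʳ : ∀ f c g → polyMul f (c ∷ g) ≋ polyAdd (map (c *_) f) (0 ∷ polyMul f g)
polyMul-∷ʳ []      c g = ≋-sym ≋.zero∷[]≈[]
polyMul-∷ʳ (b ∷ f) c g = ≋.∷-cong (cong (_+ 0) (*-comm b c))
  (≋-trans (≋.polyAdd-cong ≋-refl (polyMul-∷ʳ f c g))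
           (≡⇒≈ (x∙yz≈y∙xz (map (b *_) g) (map (c *_) f) (0 ∷ polyMul f g))))

polyMul-comm : ∀ f g → polyMul f g ≋ polyMul g f
polyMul-comm []      g = ≋-sym (polyMul-zeroʳ g)
polyMul-comm (a ∷ f) g =
  ≋-trans (≋.polyAdd-cong ≋-refl (≋.∷-cong refl (polyMul-comm f g))) (≋-sym (polyMul-∷ʳ g a f))

polyMul-identityʳ : ∀ f → polyMul f one ≋ f
polyMul-identityʳ f = ≋-trans (polyMul-comm f one) (polyMul-identityˡ f)

polyMul-distribʳ : ∀ h f g → polyMul (polyAdd f g) h ≋ polyAdd (polyMul f h) (polyMul g h)
polyMul-distribʳ h []      g       = ≋-refl
polyMul-distribʳ h (a ∷ f) []      = ≡⇒≈ (sym (polyAdd-identityʳ _))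
polyMul-distribʳ h (a ∷ f) (b ∷ g) = ≋-trans
  (≋.polyAdd-cong (≡⇒≈ (scale-distrib-+ a b h)) (≋.∷-cong refl (polyMul-distribʳ h f g)))
  (≡⇒≈ (interchange (map (a *_) h) (map (b *_) h) (0 ∷ polyMul f h) (0 ∷ polyMul g h)))

scale-polyMul : ∀ c f g → polyMul (map (c *_) f) g ≋ map (c *_) (polyMul f g)
scale-polyMul c []      g = ≋-refl
scale-polyMul c (a ∷ f) g = ≋-trans
  (≋.polyAdd-cong (≡⇒≈ (sym (scale-scale c a g))) (≋.∷-cong (sym (*-zeroʳ c)) (scale-polyMul c f g)))
  (≡⇒≈ (sym (scale-distrib-polyAdd c (map (a *_) g) (0 ∷ polyMul f g))))

polyMul-assoc : ∀ f g h → polyMul (polyMul f g) h ≋ polyMul f (polyMul g h)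
polyMul-assoc []      g h = ≋-refl
polyMul-assoc (a ∷ f) g h = ≋-trans (polyMul-distribʳ h (map (a *_) g) (0 ∷ polyMul f g))
  (≋.polyAdd-cong (scale-polyMul a g h)
    (≋-trans (polyMul-shiftˡ (polyMul f g) h) (≋.∷-cong refl (polyMul-assoc f g h))))

polySemiring : CommutativeSemiring 0ℓ 0ℓ
polySemiring = record
  { Carrier = List ℕ ; _≈_ = _≋_ ; _+_ = polyAdd ; _*_ = polyMul ; 0# = [] ; 1# = one
  ; isCommutativeSemiring = IsCommutativeSemiringˡ.isCommutativeSemiring record
    { +-isCommutativeMonoid = record
      { isMonoid = record
        { isSemigroup = record
          { isMagma = record { isEquivalence = ≋.≈-isEquivalence ; ∙-cong = ≋.polyAdd-cong }
          ; assoc = λ f g h → ≡⇒≈ (polyAdd-assoc f g h) }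
        ; identity = (λ f → ≋-refl) , (λ f → ≡⇒≈ (polyAdd-identityʳ f)) }
      ; comm = λ f g → ≡⇒≈ (polyAdd-comm f g) }
    ; *-isCommutativeMonoid = record
      { isMonoid = record
        { isSemigroup = record
          { isMagma = record { isEquivalence = ≋.≈-isEquivalence ; ∙-cong = ≋.polyMul-cong }
          ; assoc = polyMul-assoc }
        ; identity = polyMul-identityˡ , polyMul-identityʳ }
      ; comm = polyMul-comm }
    ; distribʳ = polyMul-distribʳ
    ; zeroˡ = λ f → ≋-refl } }

open MonoidMult (CommutativeSemiring.+-monoid polySemiring) using () renaming (_×_ to _·_)

coeffAt-· : ∀ n f m → coeffAt (n · f) m ≡ n * coeffAt f m
coeffAt-· zero    f m = refl
coeffAt-· (suc n) f m = trans (coeffAt-polyAdd f (n · f) m) (cong (coeffAt f m +_) (coeffAt-· n f m))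

polyPow-one : ∀ n → polyPow one n ≋ one
polyPow-one zero    = ≋-refl
polyPow-one (suc n) = ≋-trans (polyMul-identityˡ (polyPow one n)) (polyPow-one n)

X : List ℕ
X = 0 ∷ one

polyMul-X : ∀ g → polyMul X g ≋ (0 ∷ g)
polyMul-X g = ≋-trans (polyMul-shiftˡ one g) (≋.∷-cong refl (polyMul-identityˡ g))

polyMul-Xpow : ∀ n g → polyMul (polyPow X n) g ≋ replicate n 0 ++ g
polyMul-Xpow zero    g = polyMul-identityˡ g
polyMul-Xpow (suc n) g = ≋-trans (polyMul-assoc X (polyPow X n) g)
  (≋-trans (polyMul-X (polyMul (polyPow X n) g)) (≋.∷-cong refl (polyMul-Xpow n g)))

coeffAt-pad : ∀ n g m → coeffAt (replicate n 0 ++ g) (n + m) ≡ coeffAt g m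
coeffAt-pad zero    g m = refl
coeffAt-pad (suc n) g m = coeffAt-pad n g m

coeffAt-pad-< : ∀ n g {m} → m < n → coeffAt (replicate n 0 ++ g) m ≡ 0
coeffAt-pad-< (suc n) g {zero}  _         = refl
coeffAt-pad-< (suc n) g {suc m} (s≤s m<n) = coeffAt-pad-< n g m<n

open SemiringExp (CommutativeSemiring.semiring polySemiring) using (_^_; ^-assocʳ)

polyPow≡^ : ∀ f n → polyPow f n ≡ f ^ n
polyPow≡^ f zero    = refl
polyPow≡^ f (suc n) = cong (polyMul f) (polyPow≡^ f n)

polyPow-assoc : ∀ f m n → polyPow (polyPow f m) n ≋ polyPow f (m * n)
polyPow-assoc f m n = ≋-trans (≡⇒≈ (trans (polyPow≡^ _ n) (cong (_^ n) (polyPow≡^ f m))))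
  (≋-trans (^-assocʳ f m n) (≡⇒≈ (sym (polyPow≡^ f (m * n)))))

polyPow-swap : ∀ f m n → polyPow (polyPow f m) n ≋ polyPow (polyPow f n) m
polyPow-swap f m n = ≋-trans (polyPow-assoc f m n)
  (≋-trans (≡⇒≈ (cong (polyPow f) (*-comm m n))) (≋-sym (polyPow-assoc f n m)))

-- Frobenius modulo p

prime∤! : ∀ {p m} → Prime p → m < p → p ∤ m !
prime∤! {m = zero}  p-prime _   p∣1  = ¬prime[1] (subst Prime (∣1⇒≡1 p∣1) p-prime)
prime∤! {m = suc m} p-prime m<p p∣m! with euclidsLemma (suc m) (m !) p-prime p∣m!
... | inj₁ p∣1+m = <⇒≱ m<p (∣⇒≤ p∣1+m)
... | inj₂ p∣m!  = prime∤! p-prime (<-trans (n<1+n m) m<p) p∣m!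

C*factorials≡! : ∀ {n k} → k ≤ n → (n C k) * (k ! * (n ∸ k) !) ≡ n !
C*factorials≡! {n} {k} k≤n =
  trans (cong (_* (k ! * (n ∸ k) !)) (nCk≡n!/k![n-k]! k≤n)) (m/n*n≡m (k![n∸k]!∣n! k≤n))
  where instance _ = k !* (n ∸ k) !≢0

prime∣C : ∀ {p k} → Prime p → 0 < k → k < p → p ∣ p C k
prime∣C {p} {k} p-prime 0<k k<p with euclidsLemma (p C k) (k ! * (p ∸ k) !) p-prime p∣C*factorials
  where
  p∣p! : ∀ {n} → 0 < n → n ∣ n !
  p∣p! {suc n} _ = m∣m*n (n !)
  p∣C*factorials : p ∣ (p C k) * (k ! * (p ∸ k) !)
  p∣C*factorials = subst (p ∣_) (sym (C*factorials≡! (<⇒≤ k<p))) (p∣p! (<-trans 0<k k<p))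
... | inj₁ p∣C          = p∣C
... | inj₂ p∣factorials with euclidsLemma (k !) ((p ∸ k) !) p-prime p∣factorials
...   | inj₁ p∣k!       = ⊥-elim (prime∤! p-prime k<p p∣k!)
...   | inj₂ p∣[p∸k]!   = ⊥-elim (prime∤! p-prime (∸-monoʳ-< 0<k (<⇒≤ k<p)) p∣[p∸k]!)

⊖-suc-negative : ∀ {s} N → s ≤ N → ∃ λ n → s ⊖ suc N ≡ ℤ.-[1+ n ]
⊖-suc-negative {zero}  N       _         = N , refl
⊖-suc-negative {suc s} (suc N) (s≤s s≤N) with ⊖-suc-negative N s≤N
... | n , eq = n , trans (ℤ.[1+m]⊖[1+n]≡m⊖n s (suc N)) eq

module ModPrime (q : ℕ) (p-prime : Prime (suc q)) where

  p : ℕ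
  p = suc q

  infix 4 _≡ₚ_
  _≡ₚ_ : Rel ℕ 0ℓ
  x ≡ₚ y = x % p ≡ y % p

  %-cong-+ : ∀ x x′ y y′ → x ≡ₚ x′ → y ≡ₚ y′ → (x + y) ≡ₚ (x′ + y′)
  %-cong-+ x x′ y y′ e e′ = begin
    (x + y) % p             ≡⟨ %-distribˡ-+ x y p ⟩
    (x % p + y % p) % p     ≡⟨ cong₂ (λ a b → (a + b) % p) e e′ ⟩
    (x′ % p + y′ % p) % p   ≡⟨ %-distribˡ-+ x′ y′ p ⟨
    (x′ + y′) % p           ∎
    where open ≡-Reasoning

  %-cong-* : ∀ x x′ y y′ → x ≡ₚ x′ → y ≡ₚ y′ → (x * y) ≡ₚ (x′ * y′)
  %-cong-* x x′ y y′ e e′ = begin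
    (x * y) % p             ≡⟨ %-distribˡ-* x y p ⟩
    (x % p * (y % p)) % p   ≡⟨ cong₂ (λ a b → (a * b) % p) e e′ ⟩
    (x′ % p * (y′ % p)) % p ≡⟨ %-distribˡ-* x′ y′ p ⟨
    (x′ * y′) % p           ∎
    where open ≡-Reasoning

  module ≈ₚ = Coefficientwise {_≡ₚ_} (On.isEquivalence (_% p) isEquivalence) %-cong-+ %-cong-*
  open ≈ₚ using () renaming (_≈_ to _≈ₚ_)

  ≋⇒≈ₚ : ∀ {f g} → f ≋ g → f ≈ₚ g
  ≋⇒≈ₚ e = ≈ₚ.coeffwise λ n → cong (_% p) (coeff e n)

  open CommutativeSemiring polySemiring using (+-monoid)
  open MonoidSum +-monoid using (sum; sum-init-last)
  open Binomial polySemiring using (theorem; binomialTerm)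
  open CommutativeSemiringExp polySemiring using (^-distrib-*)

  multiple-≈ₚ-zero : ∀ {n} f → p ∣ n → (n · f) ≈ₚ []
  multiple-≈ₚ-zero {n} f p∣n = ≈ₚ.coeffwise λ m →
    trans (cong (_% p) (coeffAt-· n f m)) (n∣m⇒m%n≡0 _ p (∣m⇒∣m*n (coeffAt f m) p∣n))

  sum-≈ₚ-zero : ∀ {n} (t : Fin n → List ℕ) → (∀ i → t i ≈ₚ []) → sum t ≈ₚ []
  sum-≈ₚ-zero {zero}  t t≈0 = ≈ₚ.≈-refl
  sum-≈ₚ-zero {suc n} t t≈0 =
    ≈ₚ.polyAdd-cong (t≈0 fzero) (sum-≈ₚ-zero (λ i → t (fsuc i)) (λ i → t≈0 (fsuc i)))

  frobenius : ∀ f g → polyPow (polyAdd f g) p ≈ₚ polyAdd (polyPow f p) (polyPow g p)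
  frobenius f g = begin
    polyPow (polyAdd f g) p                              ≈⟨ ≋⇒≈ₚ expand ⟩
    polyAdd (term fzero) (polyAdd middle (term (fromℕ p)))
      ≈⟨ ≈ₚ.polyAdd-cong (≋⇒≈ₚ first) (≈ₚ.polyAdd-cong (sum-≈ₚ-zero _ middle≈ₚ0) (≋⇒≈ₚ last)) ⟩
    polyAdd (polyPow g p) (polyPow f p)                  ≈⟨ ≈ₚ.≡⇒≈ (polyAdd-comm (polyPow g p) (polyPow f p)) ⟩
    polyAdd (polyPow f p) (polyPow g p)                  ∎
    where
    open import Relation.Binary.Reasoning.Setoid ≈ₚ.≈-setoid
    term : Fin (suc p) → List ℕ
    term = binomialTerm f g p
    middle : List ℕ
    middle = sum (λ i → term (fsuc (inject₁ i)))
    expand : polyPow (polyAdd f g) p ≋ polyAdd (term fzero) (polyAdd middle (term (fromℕ p)))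
    expand = ≋-trans (≡⇒≈ (polyPow≡^ (polyAdd f g) p))
      (≋-trans (theorem p f g) (≋.polyAdd-cong (≋-refl {term fzero}) (sum-init-last (λ i → term (fsuc i)))))
    first : term fzero ≋ polyPow g p
    first = ≋-trans (≡⇒≈ (polyAdd-identityʳ _))
      (≋-trans (polyMul-identityˡ (g ^ p)) (≡⇒≈ (sym (polyPow≡^ g p))))
    middle≈ₚ0 : ∀ i → term (fsuc (inject₁ i)) ≈ₚ []
    middle≈ₚ0 i = multiple-≈ₚ-zero _ (prime∣C p-prime (s≤s z≤n) (s≤s (inject₁ℕ< i)))
    extreme : ℕ → List ℕ
    extreme k = (p C k) · polyMul (f ^ k) (g ^ (p ∸ k))
    last : term (fromℕ p) ≋ polyPow f p
    last = ≋-trans (≡⇒≈ (trans (cong extreme (toℕ-fromℕ p))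
                               (cong₂ (λ c k → c · polyMul (f ^ p) (g ^ k)) (nCn≡1 p) (n∸n≡0 p))))
      (≋-trans (≡⇒≈ (polyAdd-identityʳ _))
        (≋-trans (polyMul-identityʳ (f ^ p)) (≡⇒≈ (sym (polyPow≡^ f p)))))

  fermat-little : ∀ a → polyPow (a ∷ []) p ≈ₚ (a ∷ [])
  fermat-little zero    =
    ≋⇒≈ₚ (≋-trans (≋.polyMul-zeroˡ (0 ∷ []) _ ≋.zero∷[]≈[]) (≋-sym ≋.zero∷[]≈[]))
  fermat-little (suc a) = begin
    polyPow (suc a ∷ []) p                        ≡⟨ cong (λ b → polyPow (b ∷ []) p) (+-comm 1 a) ⟩
    polyPow (polyAdd (a ∷ []) one) p              ≈⟨ frobenius (a ∷ []) one ⟩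
    polyAdd (polyPow (a ∷ []) p) (polyPow one p)  ≈⟨ ≈ₚ.polyAdd-cong (fermat-little a)
                                                                      (≋⇒≈ₚ (polyPow-one p)) ⟩
    polyAdd (a ∷ []) one                          ≡⟨ cong (_∷ []) (+-comm a 1) ⟩
    suc a ∷ []                                    ∎
    where open import Relation.Binary.Reasoning.Setoid ≈ₚ.≈-setoid

  dilate : List ℕ → List ℕ
  dilate []      = []
  dilate (a ∷ f) = a ∷ replicate q 0 ++ dilate f

  polyPow-p≈ₚdilate : ∀ f → polyPow f p ≈ₚ dilate f
  polyPow-p≈ₚdilate []      = ≈ₚ.≈-refl
  polyPow-p≈ₚdilate (a ∷ f) = begin
    polyPow (a ∷ f) p                                      ≈⟨ ≋⇒≈ₚ (≋.polyPow-cong split p) ⟩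
    polyPow (polyAdd (a ∷ []) (polyMul X f)) p             ≈⟨ frobenius (a ∷ []) (polyMul X f) ⟩
    polyAdd (polyPow (a ∷ []) p) (polyPow (polyMul X f) p) ≈⟨ ≈ₚ.polyAdd-cong (fermat-little a)
                                                                                (≋⇒≈ₚ shifted) ⟩
    polyAdd (a ∷ []) (replicate p 0 ++ polyPow f p)        ≈⟨ ≈ₚ.polyAdd-cong (≈ₚ.≈-refl {a ∷ []})
                                                                (≈ₚ.pad-cong p (polyPow-p≈ₚdilate f)) ⟩
    polyAdd (a ∷ []) (replicate p 0 ++ dilate f)           ≡⟨ cong (_∷ _) (+-identityʳ a) ⟩
    dilate (a ∷ f)                                         ∎
    where
    open import Relation.Binary.Reasoning.Setoid ≈ₚ.≈-setoid
    split : (a ∷ f) ≋ polyAdd (a ∷ []) (polyMul X f)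
    split = ≋-trans (≋.∷-cong (sym (+-identityʳ a)) ≋-refl)
                    (≋.polyAdd-cong (≋-refl {a ∷ []}) (≋-sym (polyMul-X f)))
    shifted : polyPow (polyMul X f) p ≋ replicate p 0 ++ polyPow f p
    shifted = ≋-trans (≡⇒≈ (polyPow≡^ (polyMul X f) p))
      (≋-trans (^-distrib-* X f p)
        (≋-trans (≡⇒≈ (sym (cong₂ polyMul (polyPow≡^ X p) (polyPow≡^ f p))))
          (polyMul-Xpow p (polyPow f p))))

  coeffAt-dilate-multiple : ∀ f z → coeffAt (dilate f) (z * p) ≡ coeffAt f z
  coeffAt-dilate-multiple []      z       = refl
  coeffAt-dilate-multiple (a ∷ f) zero    = refl
  coeffAt-dilate-multiple (a ∷ f) (suc z) =
    trans (coeffAt-pad q (dilate f) (z * p)) (coeffAt-dilate-multiple f z)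

  coeffAt-dilate-offset : ∀ f z {s} → 0 < s → s < p → coeffAt (dilate f) (s + z * p) ≡ 0
  coeffAt-dilate-offset []      z       _ _ = refl
  coeffAt-dilate-offset (a ∷ f) zero    {suc s} _ (s≤s s<q) =
    coeffAt-pad-< q (dilate f) (subst (_< q) (sym (+-identityʳ s)) s<q)
  coeffAt-dilate-offset (a ∷ f) (suc z) {suc s} 0<s s<p = begin
    coeffAt (replicate q 0 ++ dilate f) (s + (p + z * p))       ≡⟨ cong (coeffAt (replicate q 0 ++ dilate f)) reindex ⟩
    coeffAt (replicate q 0 ++ dilate f) (q + (suc s + z * p))   ≡⟨ coeffAt-pad q (dilate f) (suc s + z * p) ⟩
    coeffAt (dilate f) (suc s + z * p)                          ≡⟨ coeffAt-dilate-offset f z 0<s s<p ⟩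
    0                                                           ∎
    where
    open ≡-Reasoning
    reindex : s + (p + z * p) ≡ q + (suc s + z * p)
    reindex = trans (+-suc s (q + z * p))
      (trans (cong suc (m+[n+o]≡n+[m+o] s q (z * p))) (sym (+-suc q (s + z * p))))

  %≡⇒mod≡ : ∀ x y → x % p ≡ y % p → x mod p ≡ y mod p
  %≡⇒mod≡ x y e = toℕ-injective (trans (toℕ-fromℕ< _) (trans e (sym (toℕ-fromℕ< _))))

  lift-reduce : ∀ f → lift (map (_mod p) f) ≈ₚ f
  lift-reduce f = ≈ₚ.coeffwise λ n →
    trans (cong (_% p) (coeffAt-lift-reduce f n)) (m%n%n≡m%n (coeffAt f n) p)
    where
    coeffAt-lift-reduce : ∀ f n → coeffAt (lift (map (_mod p) f)) n ≡ coeffAt f n % p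
    coeffAt-lift-reduce []      n       = refl
    coeffAt-lift-reduce (a ∷ f) zero    = toℕ-fromℕ< _
    coeffAt-lift-reduce (a ∷ f) (suc n) = coeffAt-lift-reduce f n

  module _ (T : List (Fin p)) where
    private
      Tᵖ = powZp p T p
      L Lᵖ : ℕ → List ℕ
      L r  = polyPow (lift T) r
      Lᵖ r = polyPow (lift Tᵖ) r

    lines-of-power : ∀ r → Lᵖ r ≈ₚ dilate (L r)
    lines-of-power r = begin
      polyPow (lift Tᵖ) r              ≈⟨ ≈ₚ.polyPow-cong (lift-reduce (L p)) r ⟩
      polyPow (polyPow (lift T) p) r   ≈⟨ ≋⇒≈ₚ (polyPow-swap (lift T) p r) ⟩
      polyPow (polyPow (lift T) r) p   ≈⟨ polyPow-p≈ₚdilate (L r) ⟩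
      dilate (L r)                     ∎
      where open import Relation.Binary.Reasoning.Setoid ≈ₚ.≈-setoid

    line-power-multiple : ∀ r z → line p Tᵖ r (z ℤ.* ℤ.+ p) ≡ line p T r z
    line-power-multiple r ℤ.-[1+ z ] = refl
    line-power-multiple r (ℤ.+ z)    = begin
      line p Tᵖ r (ℤ.+ z ℤ.* ℤ.+ p)     ≡⟨ cong (line p Tᵖ r) (ℤ.pos-* z p) ⟨
      coeffAt (Lᵖ r) (z * p) mod p       ≡⟨ %≡⇒mod≡ (coeffAt (Lᵖ r) (z * p)) (coeffAt (dilate (L r)) (z * p))
                                                    (≈ₚ.coeff (lines-of-power r) (z * p)) ⟩
      coeffAt (dilate (L r)) (z * p) mod p ≡⟨ cong (_mod p) (coeffAt-dilate-multiple (L r) z) ⟩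
      line p T r (ℤ.+ z)                 ∎
      where open ≡-Reasoning

    line-power-offset : ∀ r z {s} → 0 < s → s < p → line p Tᵖ r (ℤ.+ s ℤ.+ z ℤ.* ℤ.+ p) ≡ fzero
    line-power-offset r ℤ.-[1+ z ] 0<s (s≤s s≤q) =
      cong (line p Tᵖ r) (proj₂ (⊖-suc-negative (q + z * p) (≤-trans s≤q (m≤m+n q (z * p)))))
    line-power-offset r (ℤ.+ z) {s} 0<s s<p = begin
      line p Tᵖ r (ℤ.+ s ℤ.+ ℤ.+ z ℤ.* ℤ.+ p) ≡⟨ cong (λ x → line p Tᵖ r (ℤ.+ s ℤ.+ x)) (ℤ.pos-* z p) ⟨
      coeffAt (Lᵖ r) (s + z * p) mod p         ≡⟨ %≡⇒mod≡ (coeffAt (Lᵖ r) (s + z * p)) 0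
                                                          (trans (≈ₚ.coeff (lines-of-power r) (s + z * p))
                                                                 (cong (_% p) (coeffAt-dilate-offset (L r) z 0<s s<p))) ⟩
      fzero                                    ∎
      where open ≡-Reasoning

-- Blocks of a dilated sequence

AccessibleIn : {A : Set} → (ℕ → ℤ → A) → (c : ℕ) → Vec A c → Set
AccessibleIn H c w = Σ ℕ λ r → Σ ℤ λ j → (i : Fin c) → lookup w i ≡ H r (j ℤ.+ ℤ.+ toℕ i)

NumAccessibleIn : {A : Set} → (ℕ → ℤ → A) → ℕ → ℕ → Set
NumAccessibleIn {A} H c n =
  Σ (List (Vec A c)) λ ws → Unique ws × (∀ w → w ∈ ws ⇔ AccessibleIn H c w) × length ws ≡ n

sumBelow : (ℕ → ℕ) → ℕ → ℕ
sumBelow f zero    = 0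
sumBelow f (suc s) = f s + sumBelow f s

length-filter-≢ : ∀ {A : Set} (_≟_ : DecidableEquality A) {x} {xs : List A} → Unique xs → x ∈ xs →
                  suc (length (filter (λ y → ¬? (y ≟ x)) xs)) ≡ length xs
length-filter-≢ _≟_ {x} {x ∷ xs} (x∉xs ∷ _) (here refl) = cong suc (cong length (trans
  (filter-reject (λ y → ¬? (y ≟ x)) (λ x≢x → x≢x refl))
  (filter-all (λ y → ¬? (y ≟ x)) (All.map (λ x≢y y≡x → x≢y (sym y≡x)) x∉xs))))
length-filter-≢ _≟_ {x} {y ∷ xs} (y∉xs ∷ uniq) (there x∈xs) = cong suc (trans
  (cong length (filter-accept (λ y → ¬? (y ≟ x)) (All.lookup y∉xs x∈xs)))
  (length-filter-≢ _≟_ uniq x∈xs))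

module DilatedBlocks {A : Set} (_≟ᴬ_ : DecidableEquality A) (o : A) (p : ℕ) .{{_ : NonZero p}}
  (F G : ℕ → ℤ → A)
  (F-negative : ∀ r n → F r ℤ.-[1+ n ] ≡ o)
  (G-multiple : ∀ r z → G r (z ℤ.* ℤ.+ p) ≡ F r z)
  (G-offset : ∀ r z {s} → 0 < s → s < p → G r (ℤ.+ s ℤ.+ z ℤ.* ℤ.+ p) ≡ o)
  where

  zeros : (c : ℕ) → Vec A c
  zeros c = Vec.replicate c o

  zeros-accessible : ∀ c → AccessibleIn F c (zeros c)
  zeros-accessible c = 0 , ℤ.-[1+ c ] , λ i →
    let (n , eq) = ⊖-suc-negative c (<⇒≤ (toℕ<n i))
    in trans (lookup-replicate i o) (sym (trans (cong (F 0) eq) (F-negative 0 n)))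

  lookup-ext : ∀ {c} {u v : Vec A c} → (∀ i → lookup u i ≡ lookup v i) → u ≡ v
  lookup-ext {u = u} {v} u≗v =
    trans (sym (tabulate∘lookup u)) (trans (tabulate-cong u≗v) (tabulate∘lookup v))

  nonzero-entry : ∀ {c} (u : Vec A c) → u ≢ zeros c → ∃ λ t → lookup u t ≢ o
  nonzero-entry []      u≢0 = ⊥-elim (u≢0 refl)
  nonzero-entry (a ∷ u) u≢0 with a ≟ᴬ o
  ... | no a≢o   = fzero , a≢o
  ... | yes refl = let (t , ne) = nonzero-entry u (λ u≡0 → u≢0 (cong (o ∷_) u≡0)) in fsuc t , ne

  lookup₀ : ∀ {c} → Vec A c → ℕ → A
  lookup₀ []      t       = o
  lookup₀ (a ∷ u) zero    = a
  lookup₀ (a ∷ u) (suc t) = lookup₀ u t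

  lookup₀-toℕ : ∀ {c} (u : Vec A c) t → lookup₀ u (toℕ t) ≡ lookup u t
  lookup₀-toℕ (a ∷ u) fzero    = refl
  lookup₀-toℕ (a ∷ u) (fsuc t) = lookup₀-toℕ u t

  lookup₀-pointwise : ∀ {c} (u : Vec A c) (g : ℕ → A) → (∀ t → lookup u t ≡ g (toℕ t)) →
                      ∀ {t} → t < c → lookup₀ u t ≡ g t
  lookup₀-pointwise (a ∷ u) g u≗g {zero}  _         = u≗g fzero
  lookup₀-pointwise (a ∷ u) g u≗g {suc t} (s≤s t<c) =
    lookup₀-pointwise u (λ t → g (suc t)) (λ t → u≗g (fsuc t)) t<c

  lookup₀-zeros : ∀ c t → lookup₀ (zeros c) t ≡ o
  lookup₀-zeros zero    t       = refl
  lookup₀-zeros (suc c) zero    = refl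
  lookup₀-zeros (suc c) (suc t) = lookup₀-zeros c t

  -- A block starting at position start m z = m + z p, with m ≤ p, meets the multiples of p exactly at
  -- the offsets i ≡ phase m (mod p); the first of them is (z + carry m) p.
  phase : ℕ → ℕ
  phase m = (p ∸ m) % p

  carry : ℕ → ℕ
  carry m = (m + phase m) / p

  start : ℕ → ℤ → ℤ
  start m z = ℤ.+ m ℤ.+ z ℤ.* ℤ.+ p

  m+phase%p≡0 : ∀ {m} → m ≤ p → (m + phase m) % p ≡ 0
  m+phase%p≡0 {m} m≤p = begin
    (m + (p ∸ m) % p) % p           ≡⟨ %-distribˡ-+ m ((p ∸ m) % p) p ⟩
    (m % p + (p ∸ m) % p % p) % p   ≡⟨ cong (λ x → (m % p + x) % p) (m%n%n≡m%n (p ∸ m) p) ⟩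
    (m % p + (p ∸ m) % p) % p       ≡⟨ %-distribˡ-+ m (p ∸ m) p ⟨
    (m + (p ∸ m)) % p               ≡⟨ cong (_% p) (m+[n∸m]≡n m≤p) ⟩
    p % p                           ≡⟨ n%n≡0 p ⟩
    0                               ∎
    where open ≡-Reasoning

  phase-unique : ∀ {m} i → m ≤ p → (m + i) % p ≡ 0 → i % p ≡ phase m
  phase-unique {m} i m≤p m+i%p≡0 = begin
    i % p                           ≡⟨ [m+n]%n≡m%n i p ⟨
    (i + p) % p                     ≡⟨ cong (λ x → (i + x) % p) (m+[n∸m]≡n m≤p) ⟨
    (i + (m + (p ∸ m))) % p         ≡⟨ cong (_% p) (m+[n+o]≡o+[n+m] i m (p ∸ m)) ⟩
    ((p ∸ m) + (m + i)) % p         ≡⟨ %-distribˡ-+ (p ∸ m) (m + i) p ⟩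
    ((p ∸ m) % p + (m + i) % p) % p ≡⟨ cong (λ x → ((p ∸ m) % p + x) % p) m+i%p≡0 ⟩
    ((p ∸ m) % p + 0) % p           ≡⟨ cong (_% p) (+-identityʳ ((p ∸ m) % p)) ⟩
    (p ∸ m) % p % p                 ≡⟨ m%n%n≡m%n (p ∸ m) p ⟩
    phase m                         ∎
    where open ≡-Reasoning

  phase-hit : ∀ {m} i → m ≤ p → i % p ≡ phase m → m + i ≡ (carry m + i / p) * p
  phase-hit {m} i m≤p i%p≡phase = begin
    m + i                                       ≡⟨ cong (m +_) (m≡m%n+[m/n]*n i p) ⟩
    m + (i % p + i / p * p)                     ≡⟨ cong (λ x → m + (x + i / p * p)) i%p≡phase ⟩
    m + (phase m + i / p * p)                   ≡⟨ +-assoc m (phase m) (i / p * p) ⟨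
    m + phase m + i / p * p                     ≡⟨ cong (_+ i / p * p) (m≡m%n+[m/n]*n (m + phase m) p) ⟩
    (m + phase m) % p + carry m * p + i / p * p ≡⟨ cong (λ x → x + carry m * p + i / p * p)
                                                        (m+phase%p≡0 m≤p) ⟩
    carry m * p + i / p * p                     ≡⟨ *-distribʳ-+ p (carry m) (i / p) ⟨
    (carry m + i / p) * p                       ∎
    where open ≡-Reasoning

  phase-complement : ∀ {s} → s < p → phase (p ∸ s) ≡ s
  phase-complement s<p = trans (cong (_% p) (m∸[m∸n]≡n (<⇒≤ s<p))) (m<n⇒m%n≡m s<p)

  start-+ : ∀ m z i a b → m + i ≡ a + b * p → start m z ℤ.+ ℤ.+ i ≡ start a (z ℤ.+ ℤ.+ b)
  start-+ m z i a b m+i≡a+b*p = begin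
    (M ℤ.+ z ℤ.* P) ℤ.+ I       ≡⟨ solve 4 (λ M z I P → (M :+ z :* P) :+ I := (M :+ I) :+ z :* P) refl M z I P ⟩
    (M ℤ.+ I) ℤ.+ z ℤ.* P       ≡⟨ cong (ℤ._+ z ℤ.* P) M+I≡N+B*P ⟩
    (N ℤ.+ B ℤ.* P) ℤ.+ z ℤ.* P ≡⟨ solve 4 (λ N B z P → (N :+ B :* P) :+ z :* P := N :+ (z :+ B) :* P) refl N B z P ⟩
    N ℤ.+ (z ℤ.+ B) ℤ.* P       ∎
    where
    open ≡-Reasoning
    open +-*-Solver
    M = ℤ.+ m; I = ℤ.+ i; N = ℤ.+ a; B = ℤ.+ b; P = ℤ.+ p
    M+I≡N+B*P : M ℤ.+ I ≡ N ℤ.+ B ℤ.* P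
    M+I≡N+B*P = begin
      M ℤ.+ I             ≡⟨ ℤ.pos-+ m i ⟨
      ℤ.+ (m + i)         ≡⟨ cong ℤ.+_ m+i≡a+b*p ⟩
      ℤ.+ (a + b * p)     ≡⟨ ℤ.pos-+ a (b * p) ⟩
      N ℤ.+ ℤ.+ (b * p)   ≡⟨ cong (λ x → N ℤ.+ x) (ℤ.pos-* b p) ⟩
      N ℤ.+ B ℤ.* P       ∎

  G-hit : ∀ r {m} z i → m ≤ p → i % p ≡ phase m →
          G r (start m z ℤ.+ ℤ.+ i) ≡ F r ((z ℤ.+ ℤ.+ carry m) ℤ.+ ℤ.+ (i / p))
  G-hit r {m} z i m≤p hit = begin
    G r (start m z ℤ.+ ℤ.+ i)                      ≡⟨ cong (G r) (start-+ m z i 0 (carry m + i / p) (phase-hit i m≤p hit)) ⟩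
    G r (start 0 (z ℤ.+ ℤ.+ (carry m + i / p)))    ≡⟨ cong (G r) (ℤ.+-identityˡ _) ⟩
    G r ((z ℤ.+ ℤ.+ (carry m + i / p)) ℤ.* ℤ.+ p)  ≡⟨ G-multiple r _ ⟩
    F r (z ℤ.+ ℤ.+ (carry m + i / p))              ≡⟨ cong (λ x → F r (z ℤ.+ x)) (ℤ.pos-+ (carry m) (i / p)) ⟩
    F r (z ℤ.+ (ℤ.+ carry m ℤ.+ ℤ.+ (i / p)))      ≡⟨ cong (F r) (ℤ.+-assoc z (ℤ.+ carry m) (ℤ.+ (i / p))) ⟨
    F r ((z ℤ.+ ℤ.+ carry m) ℤ.+ ℤ.+ (i / p))      ∎
    where open ≡-Reasoning

  G-miss : ∀ r {m} z i → m ≤ p → i % p ≢ phase m → G r (start m z ℤ.+ ℤ.+ i) ≡ o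
  G-miss r {m} z i m≤p miss = trans
    (cong (G r) (start-+ m z i ((m + i) % p) ((m + i) / p) (m≡m%n+[m/n]*n (m + i) p)))
    (G-offset r (z ℤ.+ ℤ.+ ((m + i) / p)) (n≢0⇒n>0 (miss ∘ phase-unique i m≤p)) (m%n<n (m + i) p))

  -- width s is the number of positions below K in the residue class of s mod p.
  module Spread (K : ℕ) (width : ℕ → ℕ)
    (covers : ∀ i → i < K → i / p < width (i % p))
    (fits : ∀ {s t} → s < p → t < width s → s + t * p < K) where

    spreadAt : ∀ {c} → ℕ → Vec A c → ℕ → A
    spreadAt s u i with i % p ≟ s
    ... | yes _ = lookup₀ u (i / p)
    ... | no  _ = o

    spread : ∀ {c} → ℕ → Vec A c → Vec A K
    spread s u = tabulate λ i → spreadAt s u (toℕ i)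

    lookup-spread-hit : ∀ {c} s (u : Vec A c) i → toℕ i % p ≡ s →
                        lookup (spread s u) i ≡ lookup₀ u (toℕ i / p)
    lookup-spread-hit s u i hit with toℕ i % p ≟ s | lookup∘tabulate (λ i → spreadAt s u (toℕ i)) i
    ... | yes _   | eq = eq
    ... | no miss | _  = ⊥-elim (miss hit)

    lookup-spread-miss : ∀ {c} s (u : Vec A c) i → toℕ i % p ≢ s → lookup (spread s u) i ≡ o
    lookup-spread-miss s u i miss with toℕ i % p ≟ s | lookup∘tabulate (λ i → spreadAt s u (toℕ i)) i
    ... | yes hit | _  = ⊥-elim (miss hit)
    ... | no _    | eq = eq

    spread-zeros : ∀ c s → spread s (zeros c) ≡ zeros K
    spread-zeros c s = lookup-ext λ i → trans (lookup-spread-zeros i) (sym (lookup-replicate i o))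
      where
      lookup-spread-zeros : ∀ i → lookup (spread s (zeros c)) i ≡ o
      lookup-spread-zeros i with toℕ i % p ≟ s
      ... | yes hit = trans (lookup-spread-hit s (zeros c) i hit) (lookup₀-zeros c _)
      ... | no miss = lookup-spread-miss s (zeros c) i miss

    module _ {s} (s<p : s < p) where

      position : Fin (width s) → Fin K
      position t = fromℕ< (fits s<p (toℕ<n t))

      position%p : ∀ t → toℕ (position t) % p ≡ s
      position%p t = trans (cong (_% p) (toℕ-fromℕ< _)) (trans ([m+kn]%n≡m%n s (toℕ t) p) (m<n⇒m%n≡m s<p))

      position/p : ∀ t → toℕ (position t) / p ≡ toℕ t
      position/p t = trans (cong (_/ p) (toℕ-fromℕ< _))
        (trans (+-distrib-/-∣ʳ s (divides (toℕ t) refl))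
               (cong₂ _+_ (m<n⇒m/n≡0 s<p) (m*n/n≡m (toℕ t) p)))

      lookup-spread-position : ∀ (u : Vec A (width s)) t → lookup (spread s u) (position t) ≡ lookup u t
      lookup-spread-position u t = trans (lookup-spread-hit s u (position t) (position%p t))
        (trans (cong (lookup₀ u) (position/p t)) (lookup₀-toℕ u t))

      spread-injective : ∀ {u v : Vec A (width s)} → spread s u ≡ spread s v → u ≡ v
      spread-injective {u} {v} eq = lookup-ext λ t →
        trans (sym (lookup-spread-position u t))
              (trans (cong (λ w → lookup w (position t)) eq) (lookup-spread-position v t))

      spread-nonzero-entry : ∀ (u : Vec A (width s)) → u ≢ zeros (width s) →
                             ∃ λ i → toℕ i % p ≡ s × lookup (spread s u) i ≢ o
      spread-nonzero-entry u u≢0 =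
        let (t , ut≢o) = nonzero-entry u u≢0
        in position t , position%p t , λ eq → ut≢o (trans (sym (lookup-spread-position u t)) eq)

      spread-nonzero : ∀ (u : Vec A (width s)) → u ≢ zeros (width s) → spread s u ≢ zeros K
      spread-nonzero u u≢0 eq =
        let (i , _ , ≢o) = spread-nonzero-entry u u≢0
        in ≢o (trans (cong (λ w → lookup w i) eq) (lookup-replicate i o))

      spread-phase-unique : ∀ (u : Vec A (width s)) → u ≢ zeros (width s) →
                            ∀ {s′ c} (v : Vec A c) → spread s u ≡ spread s′ v → s ≡ s′
      spread-phase-unique u u≢0 {s′} v eq with spread-nonzero-entry u u≢0
      ... | i , i%p≡s , ≢o with toℕ i % p ≟ s′
      ...   | yes i%p≡s′ = trans (sym i%p≡s) i%p≡s′
      ...   | no  i%p≢s′ =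
        ⊥-elim (≢o (trans (cong (λ w → lookup w i) eq) (lookup-spread-miss s′ v i i%p≢s′)))

    lookup-spread-on : ∀ {s} (u : Vec A (width s)) (g : ℕ → A) → (∀ t → lookup u t ≡ g (toℕ t)) →
                       ∀ i → toℕ i % p ≡ s → lookup (spread s u) i ≡ g (toℕ i / p)
    lookup-spread-on {s} u g u≗g i hit = trans (lookup-spread-hit s u i hit)
      (lookup₀-pointwise u g u≗g (subst (λ s → toℕ i / p < width s) hit (covers (toℕ i) (toℕ<n i))))

    spread-accessible : ∀ {s} → s < p → ∀ (u : Vec A (width s)) →
                        AccessibleIn F (width s) u → AccessibleIn G K (spread s u)
    spread-accessible {s} s<p u (r , z′ , u≗F) = r , start m z , λ i → entry i (toℕ i % p ≟ s)
      where
      m = p ∸ s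
      z = z′ ℤ.- ℤ.+ carry m
      z+carry≡z′ : z ℤ.+ ℤ.+ carry m ≡ z′
      z+carry≡z′ = solve 2 (λ a b → (a :- b) :+ b := a) refl z′ (ℤ.+ carry m)
        where open +-*-Solver
      entry : ∀ i → Dec (toℕ i % p ≡ s) → lookup (spread s u) i ≡ G r (start m z ℤ.+ ℤ.+ toℕ i)
      entry i (yes hit) = begin
        lookup (spread s u) i                          ≡⟨ lookup-spread-on u (λ t → F r (z′ ℤ.+ ℤ.+ t)) u≗F i hit ⟩
        F r (z′ ℤ.+ ℤ.+ (toℕ i / p))                   ≡⟨ cong (λ x → F r (x ℤ.+ ℤ.+ (toℕ i / p))) z+carry≡z′ ⟨
        F r ((z ℤ.+ ℤ.+ carry m) ℤ.+ ℤ.+ (toℕ i / p))  ≡⟨ G-hit r z (toℕ i) (m∸n≤m p s)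
                                                               (trans hit (sym (phase-complement s<p))) ⟨
        G r (start m z ℤ.+ ℤ.+ toℕ i)                  ∎
        where open ≡-Reasoning
      entry i (no miss) = trans (lookup-spread-miss s u i miss)
        (sym (G-miss r z (toℕ i) (m∸n≤m p s) (miss ∘ flip trans (phase-complement s<p))))

    accessible-spread : ∀ {w} → AccessibleIn G K w →
                        ∃ λ s → s < p × Σ (Vec A (width s)) λ u → AccessibleIn F (width s) u × w ≡ spread s u
    accessible-spread {w} (r , j , w≗G) =
      s , m%n<n (p ∸ m) p , u , (r , z′ , lookup∘tabulate _) , lookup-ext λ i → entry i (toℕ i % p ≟ s)
      where
      m = j %ℕ p
      z = j /ℕ p
      m≤p : m ≤ p
      m≤p = <⇒≤ (n%ℕd<d j p)
      s = phase m
      z′ = z ℤ.+ ℤ.+ carry m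
      u : Vec A (width s)
      u = tabulate λ t → F r (z′ ℤ.+ ℤ.+ toℕ t)
      w≗G′ : ∀ i → lookup w i ≡ G r (start m z ℤ.+ ℤ.+ toℕ i)
      w≗G′ i = trans (w≗G i) (cong (λ x → G r (x ℤ.+ ℤ.+ toℕ i)) (a≡a%ℕn+[a/ℕn]*n j p))
      entry : ∀ i → Dec (toℕ i % p ≡ s) → lookup w i ≡ lookup (spread s u) i
      entry i (yes hit) = trans (w≗G′ i) (trans (G-hit r z (toℕ i) m≤p hit)
        (sym (lookup-spread-on u (λ t → F r (z′ ℤ.+ ℤ.+ t)) (lookup∘tabulate _) i hit)))
      entry i (no miss) = trans (w≗G′ i)
        (trans (G-miss r z (toℕ i) m≤p miss) (sym (lookup-spread-miss s u i miss)))

    module Enumeration (count : ℕ → ℕ) (enumerate : ∀ s → NumAccessibleIn F (width s) (count s)) where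

      nonzero? : ∀ {c} (u : Vec A c) → Dec (u ≢ zeros c)
      nonzero? u = ¬? (≡-dec _≟ᴬ_ u (zeros _))

      phaseBlocks : ℕ → List (Vec A K)
      phaseBlocks s = map (spread s) (filter nonzero? (proj₁ (enumerate s)))

      blocksBelow : ℕ → List (Vec A K)
      blocksBelow zero    = []
      blocksBelow (suc s) = phaseBlocks s ++ blocksBelow s

      module _ (s : ℕ) where
        private
          ws = proj₁ (enumerate s)
          ws-unique = proj₁ (proj₂ (enumerate s))
          ∈ws⇔ = proj₁ (proj₂ (proj₂ (enumerate s)))
          length-ws = proj₂ (proj₂ (proj₂ (enumerate s)))

        length-phaseBlocks : suc (length (phaseBlocks s)) ≡ count s
        length-phaseBlocks = begin
          suc (length (phaseBlocks s))            ≡⟨ cong suc (length-map (spread s) (filter nonzero? ws)) ⟩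
          suc (length (filter nonzero? ws))      ≡⟨ length-filter-≢ (≡-dec _≟ᴬ_) ws-unique
                                                      (Equivalence.from (∈ws⇔ _) (zeros-accessible _)) ⟩
          length ws                              ≡⟨ length-ws ⟩
          count s                                ∎
          where open ≡-Reasoning

        ∈-phaseBlocks⁻ : ∀ {w} → w ∈ phaseBlocks s → Σ (Vec A (width s)) λ u →
                         AccessibleIn F (width s) u × u ≢ zeros (width s) × w ≡ spread s u
        ∈-phaseBlocks⁻ w∈ = let (u , u∈ws , w≡ , u≢0) = ∈-map∘filter⁻ (spread s) nonzero? w∈
                            in u , Equivalence.to (∈ws⇔ u) u∈ws , u≢0 , w≡

        ∈-phaseBlocks⁺ : ∀ {u} → AccessibleIn F (width s) u → u ≢ zeros (width s) → spread s u ∈ phaseBlocks s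
        ∈-phaseBlocks⁺ {u} acc u≢0 =
          ∈-map∘filter⁺ (spread s) nonzero? (u , Equivalence.from (∈ws⇔ u) acc , refl , u≢0)

        unique-phaseBlocks : s < p → Unique (phaseBlocks s)
        unique-phaseBlocks s<p = Unique.map⁺ (spread-injective s<p) (Unique.filter⁺ nonzero? ws-unique)

      length-blocksBelow : ∀ s → length (blocksBelow s) + s ≡ sumBelow count s
      length-blocksBelow zero    = +-identityʳ 0
      length-blocksBelow (suc s) = begin
        length (phaseBlocks s ++ blocksBelow s) + suc s  ≡⟨ cong (_+ suc s) (length-++ (phaseBlocks s)) ⟩
        a + b + suc s                                    ≡⟨ +-suc (a + b) s ⟩
        suc (a + b + s)                                  ≡⟨ cong suc (+-assoc a b s) ⟩
        suc a + (b + s)                                  ≡⟨ cong₂ _+_ (length-phaseBlocks s) (length-blocksBelow s) ⟩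
        count s + sumBelow count s                       ∎
        where
        open ≡-Reasoning
        a = length (phaseBlocks s)
        b = length (blocksBelow s)

      ∈-blocksBelow⁻ : ∀ s {w} → w ∈ blocksBelow s → ∃ λ t → t < s × w ∈ phaseBlocks t
      ∈-blocksBelow⁻ (suc s) w∈ with ∈-++⁻ (phaseBlocks s) w∈
      ... | inj₁ w∈phase = s , ≤-refl , w∈phase
      ... | inj₂ w∈below =
        let (t , t<s , w∈phase) = ∈-blocksBelow⁻ s w∈below in t , m≤n⇒m≤1+n t<s , w∈phase

      ∈-blocksBelow⁺ : ∀ {s t w} → t < s → w ∈ phaseBlocks t → w ∈ blocksBelow s
      ∈-blocksBelow⁺ {suc s} {t} t<1+s w∈phase with t ≟ s
      ... | yes refl = ∈-++⁺ˡ w∈phase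
      ... | no  t≢s  =
        ∈-++⁺ʳ (phaseBlocks s) (∈-blocksBelow⁺ (≤∧≢⇒< (s≤s⁻¹ t<1+s) t≢s) w∈phase)

      nonzero-blocksBelow : ∀ s {w} → s ≤ p → w ∈ blocksBelow s → w ≢ zeros K
      nonzero-blocksBelow s s≤p w∈ with ∈-blocksBelow⁻ s w∈
      ... | t , t<s , w∈phase with ∈-phaseBlocks⁻ t w∈phase
      ...   | u , _ , u≢0 , refl = spread-nonzero (<-≤-trans t<s s≤p) u u≢0

      unique-blocksBelow : ∀ s → s ≤ p → Unique (blocksBelow s)
      unique-blocksBelow zero    _   = []
      unique-blocksBelow (suc s) s<p =
        Unique.++⁺ (unique-phaseBlocks s s<p) (unique-blocksBelow s (<⇒≤ s<p)) disjoint
        where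
        disjoint : Disjoint (phaseBlocks s) (blocksBelow s)
        disjoint (w∈phase , w∈below) with ∈-phaseBlocks⁻ s w∈phase | ∈-blocksBelow⁻ s w∈below
        ... | u , _ , u≢0 , refl | t , t<s , w∈phase′ with ∈-phaseBlocks⁻ t w∈phase′
        ...   | v , _ , _ , eq = <-irrefl (sym (spread-phase-unique s<p u u≢0 v eq)) t<s

      accessibleBlocks : List (Vec A K)
      accessibleBlocks = zeros K ∷ blocksBelow p

      zeros-accessibleᴳ : AccessibleIn G K (zeros K)
      zeros-accessibleᴳ = subst (AccessibleIn G K) (spread-zeros (width 0) 0)
        (spread-accessible (>-nonZero⁻¹ p) (zeros (width 0)) (zeros-accessible (width 0)))

      ∈-accessibleBlocks⇔ : ∀ w → w ∈ accessibleBlocks ⇔ AccessibleIn G K w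
      ∈-accessibleBlocks⇔ w = mk⇔ to from
        where
        to : w ∈ accessibleBlocks → AccessibleIn G K w
        to (here refl) = zeros-accessibleᴳ
        to (there w∈) with ∈-blocksBelow⁻ p w∈
        ... | t , t<p , w∈phase with ∈-phaseBlocks⁻ t w∈phase
        ...   | u , acc , _ , refl = spread-accessible t<p u acc
        from : AccessibleIn G K w → w ∈ accessibleBlocks
        from acc with accessible-spread acc
        ... | s , s<p , u , accᶠ , w≡ with ≡-dec _≟ᴬ_ u (zeros (width s))
        ...   | yes refl = here (trans w≡ (spread-zeros (width s) s))
        ...   | no  u≢0  =
          there (subst (_∈ blocksBelow p) (sym w≡) (∈-blocksBelow⁺ s<p (∈-phaseBlocks⁺ s accᶠ u≢0)))

      numAccessible : NumAccessibleIn G K (sumBelow count p + 1 ∸ p)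
      numAccessible = accessibleBlocks
                    , All.tabulate (λ w∈ 0≡w → nonzero-blocksBelow p ≤-refl w∈ (sym 0≡w)) ∷ unique-blocksBelow p ≤-refl
                    , ∈-accessibleBlocks⇔
                    , sym (begin
                        sumBelow count p + 1 ∸ p          ≡⟨ cong (λ x → x + 1 ∸ p) (length-blocksBelow p) ⟨
                        length (blocksBelow p) + p + 1 ∸ p ≡⟨ cong (_∸ p) (+-comm _ 1) ⟩
                        suc (length (blocksBelow p)) + p ∸ p ≡⟨ m+n∸n≡m _ p ⟩
                        suc (length (blocksBelow p))       ∎)
        where open ≡-Reasoning

  module _ (k r : ℕ) (r<p : r < p) {n m : ℕ}
           (#k : NumAccessibleIn F k n) (#k+1 : NumAccessibleIn F (suc k) m) where

    width : ℕ → ℕ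
    width s with s <? r
    ... | yes _ = suc k
    ... | no  _ = k

    count : ℕ → ℕ
    count s with s <? r
    ... | yes _ = m
    ... | no  _ = n

    enumerate : ∀ s → NumAccessibleIn F (width s) (count s)
    enumerate s with s <? r
    ... | yes _ = #k+1
    ... | no  _ = #k

    K : ℕ
    K = p * k + r

    K≡ : K ≡ r + k * p
    K≡ = trans (+-comm (p * k) r) (cong (r +_) (*-comm p k))

    covers : ∀ i → i < K → i / p < width (i % p)
    covers i i<K with i % p <? r
    ... | yes i%p<r = *-cancelʳ-< p (i / p) (suc k) (begin-strict
      i / p * p      ≤⟨ m/n*n≤m i p ⟩
      i              <⟨ i<K ⟩
      K              ≡⟨ K≡ ⟩
      r + k * p      <⟨ +-monoˡ-< (k * p) r<p ⟩
      p + k * p      ∎)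
      where open ≤-Reasoning
    ... | no  i%p≮r = *-cancelʳ-< p (i / p) k (+-cancelˡ-< r _ _ (begin-strict
      r + i / p * p      ≤⟨ +-monoˡ-≤ (i / p * p) (≮⇒≥ i%p≮r) ⟩
      i % p + i / p * p  ≡⟨ m≡m%n+[m/n]*n i p ⟨
      i                  <⟨ i<K ⟩
      K                  ≡⟨ K≡ ⟩
      r + k * p          ∎))
      where open ≤-Reasoning

    fits : ∀ {s t} → s < p → t < width s → s + t * p < K
    fits {s} {t} s<p t<width with s <? r
    ... | yes s<r = begin-strict
      s + t * p   <⟨ +-monoˡ-< (t * p) s<r ⟩
      r + t * p   ≤⟨ +-monoʳ-≤ r (*-monoˡ-≤ p (s≤s⁻¹ t<width)) ⟩
      r + k * p   ≡⟨ K≡ ⟨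
      K           ∎
      where open ≤-Reasoning
    ... | no _ = begin-strict
      s + t * p   <⟨ +-monoˡ-< (t * p) s<p ⟩
      p + t * p   ≤⟨ *-monoˡ-≤ p t<width ⟩
      k * p       ≤⟨ m≤n+m (k * p) r ⟩
      r + k * p   ≡⟨ K≡ ⟨
      K           ∎
      where open ≤-Reasoning

    sumBelow-count-below : ∀ s → s ≤ r → sumBelow count s ≡ s * m
    sumBelow-count-below zero    _   = refl
    sumBelow-count-below (suc s) s<r with s <? r
    ... | yes _   = cong (m +_) (sumBelow-count-below s (<⇒≤ s<r))
    ... | no  s≮r = ⊥-elim (s≮r s<r)

    sumBelow-count-above : ∀ d → sumBelow count (d + r) ≡ d * n + r * m
    sumBelow-count-above zero    = sumBelow-count-below r ≤-refl
    sumBelow-count-above (suc d) with d + r <? r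
    ... | yes d+r<r = ⊥-elim (<⇒≱ d+r<r (m≤n+m r d))
    ... | no  _     = trans (cong (n +_) (sumBelow-count-above d)) (sym (+-assoc n (d * n) (r * m)))

    sumBelow-count : sumBelow count p ≡ (p ∸ r) * n + r * m
    sumBelow-count = trans (cong (sumBelow count) (sym (m∸n+n≡m (<⇒≤ r<p)))) (sumBelow-count-above (p ∸ r))

    numAccessible-dilated : NumAccessibleIn G (p * k + r) ((p ∸ r) * n + r * m + 1 ∸ p)
    numAccessible-dilated = subst (λ x → NumAccessibleIn G K (x + 1 ∸ p)) sumBelow-count
      (Spread.Enumeration.numAccessible K width covers fits count enumerate)

mainTheorem13 : (p : ℕ) .{{_ : NonZero p}} → Prime p → (T : List (Fin p)) →
    (r : ℕ) → r < p → (k : ℕ) → 1 ≤ k → (n m : ℕ) →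
    NumAccessible p T k n → NumAccessible p T (suc k) m →
    NumAccessible p (powZp p T p) (p * k + r) ((p ∸ r) * n + r * m + 1 ∸ p)
mainTheorem13 zero    p-prime = ⊥-elim (¬prime[0] p-prime)
mainTheorem13 (suc q) p-prime T r r<p k _ n m #k #k+1 = numAccessible-dilated k r r<p #k #k+1
  where
  open ModPrime q p-prime
  open DilatedBlocks _≟ᶠ_ fzero p (line p T) (line p (powZp p T p))
    (λ _ _ → refl) (line-power-multiple T) (line-power-offset T)
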